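{- Let $G$ be a digraph on $n$ vertices with $\delta^+(G) > n/2$. Then there exists a set $T$ of three vertices which spans a triangle $K_3$ in the base graph of $G$ and such that $\delta^+(G[T]) \ge 1$, i.e. every vertex of $T$ has an out-neighbour in $T$.
   Context: A digraph has no loops and at most one arc from $x$ to $y$ for each ordered pair $(x,y)$ (arcs in both directions are allowed). $\delta^+(G)$ is the minimum out-degree. The base graph of a digraph $G$ is the undirected graph on $V(G)$ with an edge $xy$ whenever $xy$ or $yx$ is an arc of $G$. $G[T]$ is the subdigraph induced on $T$. -}

module Defs where

open import Data.Nat using (ℕ; _+_)
open import Data.Bool using (Bool; true; false; T)
open import Data.Fin using (Fin)
open import Data.Fin.Subset using (Subset; ∣_∣)
open import Data.Vec using (tabulate)
open import Data.Sum using (_⊎_)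
open import Data.Product using (_×_)
open import Relation.Binary.PropositionalEquality using (_≡_)
open import Relation.Nullary using (¬_)

-- At most one arc per ordered pair is
-- automatic; arcs in both directions are allowed.
record Digraph (n : ℕ) : Set where
  field
    arc      : Fin n → Fin n → Bool
    loopless : ∀ x → arc x x ≡ false
open Digraph public

Arc : ∀ {n} → Digraph n → Fin n → Fin n → Set
Arc G x y = T (arc G x y)

outNbhd : ∀ {n} → Digraph n → Fin n → Subset n
outNbhd G x = tabulate (arc G x)

outdeg : ∀ {n} → Digraph n → Fin n → ℕ
outdeg G x = ∣ outNbhd G x ∣

BaseEdge : ∀ {n} → Digraph n → Fin n → Fin n → Set
BaseEdge G x y = Arc G x y ⊎ Arc G y x

BaseTriangle : ∀ {n} → Digraph n → Fin n → Fin n → Fin n → Set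
BaseTriangle G a b c =
  ¬ a ≡ b × ¬ b ≡ c × ¬ a ≡ c ×
  BaseEdge G a b × BaseEdge G b c × BaseEdge G a c

MinOutdegPos3 : ∀ {n} → Digraph n → Fin n → Fin n → Fin n → Set
MinOutdegPos3 G a b c =
  (Arc G a b ⊎ Arc G a c) ×
  (Arc G b a ⊎ Arc G b c) ×
  (Arc G c a ⊎ Arc G c b)

-- Counting arcs twice, the in-degrees have the same sum as the out-degrees, so some
-- vertex z has in-degree > n/2.  Two sets of size > n/2 in an n-set meet: the
-- out- and in-neighbourhoods of z share a vertex w (so z → w → z), and the
-- out-neighbourhood of w meets the in-neighbourhood of z in a vertex c (so w → c → z).
-- On {w, z, c} the arcs w → z, z → w, c → z give every vertex an out-neighbour, and
-- with w → c all three pairs are adjacent.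
module Submission where

open import Defs
open import Data.Nat using (ℕ; zero; suc; _+_; _*_; _≤_; _<_; _<?_; z≤n)
open import Data.Nat.Properties
open import Data.Fin using (Fin; zero; suc)
open import Data.Fin.Subset using (Subset; ∣_∣; _∈_; _∩_; _⊆_; ∁; Nonempty)
open import Data.Fin.Subset.Properties using (nonempty?; x∈p∩q⁺; x∈p∩q⁻; x∉p⇒x∈∁p; p⊆q⇒∣p∣≤∣q∣; ∣∁p∣≡n∸∣p∣; ∣p∣≤n)
open import Data.Vec using (tabulate)
open import Data.Vec.Properties using ([]=⇒lookup; lookup∘tabulate)
open import Data.Vec.Functional using (Vector)
open import Data.Bool using (Bool; true; false; T; if_then_else_)
open import Data.Bool.Properties using (T-≡)
open import Data.Product using (Σ; ∃; _×_; _,_)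
open import Data.Sum using (inj₁; inj₂)
open import Function using (_∘_; Equivalence)
open import Relation.Binary.PropositionalEquality
open import Relation.Nullary using (¬_; yes; no; contradiction)
open import Algebra.Properties.Semiring.Sum +-*-semiring using (sum; sum-syntax; ∑-comm; sum-cong-≗; *-distribˡ-sum)

n<∣p∣+∣q∣⇒p∩q≢∅ : ∀ {n} (p q : Subset n) → n < ∣ p ∣ + ∣ q ∣ → Nonempty (p ∩ q)
n<∣p∣+∣q∣⇒p∩q≢∅ {n} p q n<∣p∣+∣q∣ with nonempty? (p ∩ q)
... | yes p∩q≢∅ = p∩q≢∅
... | no  p∩q≡∅ = contradiction ∣p∣+∣q∣≤n (<⇒≱ n<∣p∣+∣q∣)
  where
  p⊆∁q : p ⊆ ∁ q
  p⊆∁q x∈p = x∉p⇒x∈∁p (λ x∈q → p∩q≡∅ (_ , x∈p∩q⁺ (x∈p , x∈q)))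

  ∣p∣+∣q∣≤n : ∣ p ∣ + ∣ q ∣ ≤ n
  ∣p∣+∣q∣≤n = m≤o∸n⇒m+n≤o ∣ p ∣ (∣p∣≤n q)
    (subst (∣ p ∣ ≤_) (∣∁p∣≡n∸∣p∣ q) (p⊆q⇒∣p∣≤∣q∣ p⊆∁q))

x∈tabulate⇒T : ∀ {n} {f : Fin n → Bool} {x} → x ∈ tabulate f → T (f x)
x∈tabulate⇒T {f = f} {x} x∈f = Equivalence.from T-≡
  (trans (sym (lookup∘tabulate f x)) ([]=⇒lookup x∈f))

∣tabulate∣≡∑ : ∀ {n} (f : Fin n → Bool) → ∣ tabulate f ∣ ≡ ∑[ x < n ] (if f x then 1 else 0)
∣tabulate∣≡∑ {zero}  f = refl
∣tabulate∣≡∑ {suc n} f with f zero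
... | true  = cong suc (∣tabulate∣≡∑ (f ∘ suc))
... | false = ∣tabulate∣≡∑ (f ∘ suc)

∑-mono-≤ : ∀ {n} {f g : Vector ℕ n} → (∀ i → f i ≤ g i) → sum f ≤ sum g
∑-mono-≤ {zero}  _   = z≤n
∑-mono-≤ {suc n} f≤g = +-mono-≤ (f≤g zero) (∑-mono-≤ (f≤g ∘ suc))

∑-mono-< : ∀ {n} {f g : Vector ℕ n} → 0 < n → (∀ i → f i < g i) → sum f < sum g
∑-mono-< {suc n} _ f<g = +-mono-<-≤ (f<g zero) (∑-mono-≤ (<⇒≤ ∘ f<g ∘ suc))

∑<∑⇒∃< : ∀ {n} (f g : Vector ℕ n) → sum f < sum g → ∃ λ i → f i < g i
∑<∑⇒∃< {suc n} f g ∑f<∑g with f zero <? g zero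
... | yes f₀<g₀ = zero , f₀<g₀
... | no  f₀≮g₀ =
  let i , fᵢ<gᵢ = ∑<∑⇒∃< (f ∘ suc) (g ∘ suc)
                    (+-cancelˡ-< (g zero) _ _ (≤-<-trans (+-monoˡ-≤ _ (≮⇒≥ f₀≮g₀)) ∑f<∑g))
  in suc i , fᵢ<gᵢ

m<2*a⇒m<2*b⇒m<a+b : ∀ {m} a b → m < 2 * a → m < 2 * b → m < a + b
m<2*a⇒m<2*b⇒m<a+b {m} a b m<2a m<2b = *-cancelˡ-< 2 m (a + b) (begin-strict
  2 * m          ≡⟨ cong (m +_) (+-identityʳ m) ⟩
  m + m          <⟨ +-mono-< m<2a m<2b ⟩
  2 * a + 2 * b  ≡⟨ *-distribˡ-+ 2 a b ⟨
  2 * (a + b)    ∎)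
  where open ≤-Reasoning

inNbhd : ∀ {n} → Digraph n → Fin n → Subset n
inNbhd G y = tabulate (λ x → arc G x y)

indeg : ∀ {n} → Digraph n → Fin n → ℕ
indeg G y = ∣ inNbhd G y ∣

Arc⇒≢ : ∀ {n} (G : Digraph n) {x y} → Arc G x y → ¬ x ≡ y
Arc⇒≢ G {x} x→x refl = subst T (loopless G x) x→x

∑outdeg≡∑indeg : ∀ {n} (G : Digraph n) → ∑[ x < n ] outdeg G x ≡ ∑[ y < n ] indeg G y
∑outdeg≡∑indeg {n} G = begin
  ∑[ x < n ] outdeg G x                              ≡⟨ sum-cong-≗ (λ x → ∣tabulate∣≡∑ (arc G x)) ⟩
  ∑[ x < n ] ∑[ y < n ] (if arc G x y then 1 else 0) ≡⟨ ∑-comm (λ x y → if arc G x y then 1 else 0) ⟩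
  ∑[ y < n ] ∑[ x < n ] (if arc G x y then 1 else 0) ≡⟨ sum-cong-≗ (λ y → ∣tabulate∣≡∑ (λ x → arc G x y)) ⟨
  ∑[ y < n ] indeg G y                               ∎
  where open ≡-Reasoning

∃-indeg> : ∀ {n} (G : Digraph n) k m → 0 < n → (∀ x → k < m * outdeg G x) →
           ∃ λ z → k < m * indeg G z
∃-indeg> {n} G k m 0<n k<outdeg = ∑<∑⇒∃< (λ _ → k) (λ z → m * indeg G z) (begin-strict
  ∑[ x < n ] k                   <⟨ ∑-mono-< 0<n k<outdeg ⟩
  ∑[ x < n ] (m * outdeg G x)    ≡⟨ *-distribˡ-sum m (outdeg G) ⟨
  m * (∑[ x < n ] outdeg G x)    ≡⟨ cong (m *_) (∑outdeg≡∑indeg G) ⟩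
  m * (∑[ z < n ] indeg G z)     ≡⟨ *-distribˡ-sum m (indeg G) ⟩
  ∑[ z < n ] (m * indeg G z)     ∎)
  where open ≤-Reasoning

∃-2-path : ∀ {n} (G : Digraph n) x y → n < outdeg G x + indeg G y →
           ∃ λ w → Arc G x w × Arc G w y
∃-2-path G x y n<out+in =
  let w , w∈out∩in = n<∣p∣+∣q∣⇒p∩q≢∅ (outNbhd G x) (inNbhd G y) n<out+in
      w∈out , w∈in = x∈p∩q⁻ (outNbhd G x) (inNbhd G y) w∈out∩in
  in w , x∈tabulate⇒T w∈out , x∈tabulate⇒T w∈in

corollary3p1 : (n : ℕ) → 0 < n → (G : Digraph n) →
    ((x : Fin n) → n < 2 * outdeg G x) →
    Σ (Fin n) λ a → Σ (Fin n) λ b → Σ (Fin n) λ c →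
      BaseTriangle G a b c × MinOutdegPos3 G a b c
corollary3p1 n 0<n G δ⁺>n/2 =
  let z , d⁻z>n/2 = ∃-indeg> G n 2 0<n δ⁺>n/2
      w , z→w , w→z = ∃-2-path G z z (m<2*a⇒m<2*b⇒m<a+b (outdeg G z) (indeg G z) (δ⁺>n/2 z) d⁻z>n/2)
      c , w→c , c→z = ∃-2-path G w z (m<2*a⇒m<2*b⇒m<a+b (outdeg G w) (indeg G z) (δ⁺>n/2 w) d⁻z>n/2)
  in w , z , c
     , (Arc⇒≢ G w→z , Arc⇒≢ G c→z ∘ sym , Arc⇒≢ G w→c , inj₁ w→z , inj₂ c→z , inj₁ w→c)
     , (inj₁ w→z , inj₁ z→w , inj₂ c→z)
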